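{- Let $\mathcal{B}$ be a connected building set on a finite set $E$, and let $T,T'$ be maximal $\mathcal{B}$-trees with $s\neq s'\in E$ such that $s$ is a child of $s'$ in $T$, $s'$ is a child of $s$ in $T'$, and contracting the edge $\{s,s'\}$ in both trees yields the same labeled rooted tree. If $D(s,T)\cap D(s',T')\in\mathcal{B}\cup\{\varnothing\}$, then $\Delta(T,T')>0$.
   Context: A building set on $E$ is a collection $\mathcal{B}$ of non-empty subsets of $E$ closed under union of intersecting members and containing all singletons; connected means $E\in\mathcal{B}$. For a vertex $v$ of a rooted tree $T$ labeled by subsets of $E$, $D(v,T)$ is the union of labels of all descendants of $v$ (including $v$). A $\mathcal{B}$-tree is a rooted tree whose labels partition $E$ with $D(v,T)\in\mathcal{B}$ for all $v$ and $\bigcup_iD(v_i,T)\notin\mathcal{B}$ for any $k\ge2$ pairwise incomparable vertices $v_i$; it is maximal if all labels are singletons (vertices identified with elements of $E$). In the situation of the claim, let $S$ (resp. $S'$) be the elements that are children of $s$ (resp. $s'$) in both trees, $R$ those that are children of $s$ in $T$ and of $s'$ in $T'$, $R'$ those that are children of $s'$ in $T$ and of $s$ in $T'$; for $x$ in these sets $D(x)=D(x,T)=D(x,T')$; $\delta_X=\sum_{x\in X}|D(x)|$, $\pi_X=\sum_{\{x,x'\}\subseteq X,x\ne x'}|D(x)||D(x')|$, and $\Delta(T,T')=(\delta_S+1)(\delta_{S'}+1)+\delta_{R'}(\delta_S+\delta_{S'}+\delta_R+2)+\pi_{R'}-\pi_R$. -}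

module Defs where

open import Data.Nat as ℕ using (ℕ; zero; suc; _≤_; _<ᵇ_)
open import Data.Fin using (Fin; toℕ) renaming (_≟_ to _≟F_)
open import Data.Fin.Subset using (Subset; inside; outside; _∈_; _∉_; _∪_; _∩_; ⁅_⁆; ⊤; ⊥; ⋃; ∣_∣; Nonempty)
open import Data.Vec using (tabulate)
open import Data.Bool using (Bool; true; false; if_then_else_; _∧_)
open import Data.Maybe using (Maybe; just; nothing)
open import Data.Maybe.Properties using (≡-dec)
open import Data.List using (List; allFin; upTo; map; length)
open import Data.Bool.ListAction using (any)
open import Data.Nat.ListAction using (sum)
open import Data.List.Relation.Unary.AllPairs using (AllPairs)
open import Data.Product using (_×_; ∃-syntax)
open import Data.Integer as ℤ using (ℤ; +_; _-_)
open import Relation.Nullary using (¬_)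
open import Relation.Nullary.Decidable using (⌊_⌋)
open import Relation.Binary.PropositionalEquality using (_≡_; _≢_)

record IsBuildingSet {n : ℕ} (B : Subset n → Set) : Set where
  field
    nonempty   : ∀ X → B X → Nonempty X
    union      : ∀ X Y → B X → B Y → Nonempty (X ∩ Y) → B (X ∪ Y)
    singletons : ∀ (e : Fin n) → B ⁅ e ⁆

IsConnected : {n : ℕ} → (Subset n → Set) → Set
IsConnected B = B ⊤

-- A rooted tree whose vertices are the elements of E (all labels singletons),
-- given by its parent map (nothing = root).
Parent : ℕ → Set
Parent n = Fin n → Maybe (Fin n)

step : {n : ℕ} → Parent n → Maybe (Fin n) → Maybe (Fin n)
step p nothing  = nothing
step p (just v) = p v

iter : {n : ℕ} → Parent n → ℕ → Maybe (Fin n) → Maybe (Fin n)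
iter p zero    m = m
iter p (suc k) m = step p (iter p k m)

record IsRootedTree {n : ℕ} (p : Parent n) : Set where
  field
    root        : Fin n
    root-parent : p root ≡ nothing
    root-unique : ∀ v → p v ≡ nothing → v ≡ root
    reaches     : ∀ v → ∃[ k ] iter p k (just v) ≡ nothing

_≟M_ : {n : ℕ} → (a b : Maybe (Fin n)) → _
_≟M_ = ≡-dec _≟F_

-- v is a descendant of x (including v = x). In a tree on n vertices
-- depth < n, so looking at most n steps up is exhaustive.
isDesc : {n : ℕ} → Parent n → Fin n → Fin n → Bool
isDesc {n} p x v = any (λ k → ⌊ iter p k (just v) ≟M just x ⌋) (upTo (suc n))

D : {n : ℕ} → Parent n → Fin n → Subset n
D p x = tabulate (λ v → if isDesc p x v then inside else outside)

Incomparable : {n : ℕ} → Parent n → Fin n → Fin n → Set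
Incomparable p x y = (x ∉ D p y) × (y ∉ D p x)

record IsMaximalBTree {n : ℕ} (B : Subset n → Set) (p : Parent n) : Set where
  field
    tree     : IsRootedTree p
    D∈B      : ∀ v → B (D p v)
    antichain : ∀ (vs : List (Fin n)) → 2 ≤ length vs →
                AllPairs (Incomparable p) vs → ¬ B (⋃ (map (D p) vs))

isChild : {n : ℕ} → Parent n → Fin n → Fin n → Bool
isChild p x s = ⌊ p x ≟M just s ⌋

-- merge s' into s : the vertex {s,s'} of the contracted tree is named s
mergeV : {n : ℕ} → Fin n → Fin n → Fin n → Fin n
mergeV s s' v = if ⌊ v ≟F s' ⌋ then s else v

mergeM : {n : ℕ} → Fin n → Fin n → Maybe (Fin n) → Maybe (Fin n)
mergeM s s' nothing  = nothing
mergeM s s' (just v) = just (mergeV s s' v)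

-- Contracting edge {s,s'} in T (where s' is the upper endpoint in T, i.e. s
-- is a child of s') and in T' (where s is the upper endpoint) gives the same
-- labeled rooted tree: same parent of every other vertex, and same parent of
-- the merged vertex {s,s'}.
SameContraction : {n : ℕ} → Parent n → Parent n → Fin n → Fin n → Set
SameContraction T T' s s' =
  (∀ v → v ≢ s → v ≢ s' → mergeM s s' (T v) ≡ mergeM s s' (T' v)) ×
  (mergeM s s' (T s') ≡ mergeM s s' (T' s))

sumOver : {n : ℕ} → (Fin n → Bool) → (Fin n → ℕ) → ℕ
sumOver {n} P f = sum (map (λ x → if P x then f x else 0) (allFin n))

δ : {n : ℕ} → Parent n → (Fin n → Bool) → ℕ
δ T X = sumOver X (λ x → ∣ D T x ∣)

-- sum over unordered pairs {x,x'} ⊆ X, x ≠ x' (each counted once via toℕ x < toℕ x')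
π : {n : ℕ} → Parent n → (Fin n → Bool) → ℕ
π T X = sumOver X (λ x → sumOver (λ y → X y ∧ (toℕ x <ᵇ toℕ y)) (λ y → ∣ D T x ∣ ℕ.* ∣ D T y ∣))

Sset Sset' Rset Rset' : {n : ℕ} → Parent n → Parent n → Fin n → Fin n → Fin n → Bool
Sset  T T' s s' x = isChild T x s  ∧ isChild T' x s
Sset' T T' s s' x = isChild T x s' ∧ isChild T' x s'
Rset  T T' s s' x = isChild T x s  ∧ isChild T' x s'
Rset' T T' s s' x = isChild T x s' ∧ isChild T' x s

-- Δ(T,T') (D(x) computed in T; equal to D(x,T') for x in these sets)
Δ : {n : ℕ} → Parent n → Parent n → Fin n → Fin n → ℤ
Δ T T' s s' =
  let dS  = δ T (Sset T T' s s')
      dS' = δ T (Sset' T T' s s')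
      dR  = δ T (Rset T T' s s')
      dR' = δ T (Rset' T T' s s')
  in (+ (suc dS ℕ.* suc dS' ℕ.+ dR' ℕ.* (dS ℕ.+ dS' ℕ.+ dR ℕ.+ 2) ℕ.+ π T (Rset' T T' s s')))
     - (+ π T (Rset T T' s s'))

-- All summands of Δ(T,T') other than −π_R are natural numbers and (δ_S+1)(δ_{S'}+1) ≥ 1, so it
-- suffices that R has at most one element. The sets D(x) for x ∈ R cover exactly D(s,T) ∩ D(s',T'),
-- because the two trees agree below every child of s in T. Distinct elements of R are siblings in T,
-- hence incomparable, so with two of them the antichain condition of the maximal B-tree T forbids
-- D(s,T) ∩ D(s',T') ∈ B; and if that intersection is empty, R is empty.

module Submission where

open import Defs
open import Data.Bool as Bool using (Bool; true; false; if_then_else_)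
open import Data.Bool.Properties using (T-∧)
open import Data.Empty using (⊥-elim)
open import Data.Fin as Fin using (Fin; toℕ) renaming (_≟_ to _≟F_)
open import Data.Fin.Properties using (pigeonhole; toℕ≤pred[n])
open import Data.Fin.Subset using (Subset; inside; outside; _∈_; _∩_; ⋃; ⊥)
open import Data.Fin.Subset.Properties using (x∈p∩q⁺; x∈p∩q⁻; x∈p∪q⁺; x∈p∪q⁻; ∉⊥; ⊆-antisym)
open import Data.Integer as ℤ using (+_; +<+)
open import Data.List using (List; []; _∷_; map; length; upTo; allFin; filterᵇ)
open import Data.List.Membership.Propositional using (lose) renaming (_∈_ to _∈ₗ_)
open import Data.List.Membership.Propositional.Properties
  using (∈-length; ∈-upTo⁺; ∈-allFin; ∈-map⁺; ∈-map⁻; ∈-filter⁺; ∈-filter⁻)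
open import Data.List.Relation.Unary.All as All using (All; []; _∷_)
open import Data.List.Relation.Unary.All.Properties using (all-filter)
open import Data.List.Relation.Unary.AllPairs using (AllPairs; []; _∷_)
import Data.List.Relation.Unary.AllPairs.Properties as AllPairs
open import Data.List.Relation.Unary.Any using (here; there; satisfied)
open import Data.List.Relation.Unary.Any.Properties using (any⁺; any⁻)
open import Data.List.Relation.Unary.Unique.Propositional.Properties using (allFin⁺)
open import Data.Maybe using (just; nothing)
open import Data.Maybe.Properties using (just-injective)
open import Data.Nat as ℕ using (ℕ; zero; suc; _+_; _*_; _∸_; _≤_; _<_; z≤n; s≤s; z<s)
open import Data.Nat.ListAction using (sum)
open import Data.Nat.Properties
open import Data.Product using (∃-syntax; ∃₂; _×_; _,_; proj₁; proj₂)
open import Data.Sum using (_⊎_; inj₁; inj₂)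
open import Data.Unit using (tt)
open import Data.Vec using (tabulate)
open import Data.Vec.Properties using (lookup∘tabulate; []=⇒lookup; lookup⇒[]=)
open import Function using (_∘_)
open import Function.Bundles using (Equivalence)
open import Relation.Nullary using (¬_; yes; no; contradiction)
open import Relation.Nullary.Decidable using (toWitness; fromWitness; T?)
open import Relation.Binary.PropositionalEquality
open ≡-Reasoning

module _ {n : ℕ} (f : Fin n → Bool) where

  ∈-tabulate-if⁻ : ∀ x → x ∈ tabulate (λ v → if f v then inside else outside) → Bool.T (f x)
  ∈-tabulate-if⁻ x x∈ with f x | trans (sym (lookup∘tabulate (λ v → if f v then inside else outside) x)) ([]=⇒lookup x∈)
  ... | true | _ = tt

  ∈-tabulate-if⁺ : ∀ x → Bool.T (f x) → x ∈ tabulate (λ v → if f v then inside else outside)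
  ∈-tabulate-if⁺ x fx = lookup⇒[]= x _ (trans (lookup∘tabulate _ x) (if-inside (f x) fx))
    where
    if-inside : ∀ b → Bool.T b → (if b then inside else outside) ≡ inside
    if-inside true _ = refl

module _ {n : ℕ} {x : Fin n} where

  ∈-⋃⁺ : ∀ {X Xs} → X ∈ₗ Xs → x ∈ X → x ∈ ⋃ Xs
  ∈-⋃⁺ (here refl) x∈X = x∈p∪q⁺ (inj₁ x∈X)
  ∈-⋃⁺ (there X∈)  x∈X = x∈p∪q⁺ (inj₂ (∈-⋃⁺ X∈ x∈X))

  ∈-⋃⁻ : ∀ Xs → x ∈ ⋃ Xs → ∃[ X ] X ∈ₗ Xs × x ∈ X
  ∈-⋃⁻ []       x∈ = contradiction x∈ ∉⊥
  ∈-⋃⁻ (X ∷ Xs) x∈ with x∈p∪q⁻ X (⋃ Xs) x∈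
  ... | inj₁ x∈X = X , here refl , x∈X
  ... | inj₂ x∈⋃ with ∈-⋃⁻ Xs x∈⋃
  ...   | Y , Y∈ , x∈Y = Y , there Y∈ , x∈Y

module _ {A : Set} where

  distinct-members⇒2≤length : ∀ {x y : A} {xs} → x ∈ₗ xs → y ∈ₗ xs → x ≢ y → 2 ≤ length xs
  distinct-members⇒2≤length (here refl) (here refl) x≢y = contradiction refl x≢y
  distinct-members⇒2≤length (here _)    (there y∈)  _   = s≤s (∈-length y∈)
  distinct-members⇒2≤length (there x∈)  _           _   = s≤s (∈-length x∈)

  allPairs-within : ∀ {P : A → Set} {R S : A → A → Set} →
                    (∀ {x y} → P x → P y → R x y → S x y) →
                    ∀ {xs} → All P xs → AllPairs R xs → AllPairs S xs
  allPairs-within f []         []           = []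
  allPairs-within f (px ∷ pxs) (rx ∷ rxs) =
    All.zipWith (λ (py , r) → f px py r) (pxs , rx) ∷ allPairs-within f pxs rxs

module _ {n : ℕ} (p : Parent n) where

  iter-nothing : ∀ k → iter p k nothing ≡ nothing
  iter-nothing zero    = refl
  iter-nothing (suc k) = cong (step p) (iter-nothing k)

  iter-+ : ∀ j k m → iter p (j + k) m ≡ iter p j (iter p k m)
  iter-+ zero    k m = refl
  iter-+ (suc j) k m = cong (step p) (iter-+ j k m)

  iter-suc : ∀ k v → iter p (suc k) (just v) ≡ iter p k (p v)
  iter-suc k v = trans (cong (λ i → iter p i (just v)) (+-comm 1 k)) (iter-+ k 1 (just v))

  iter-∸ : ∀ {k l m a} → k ≤ l → iter p k m ≡ just a → iter p (l ∸ k) (just a) ≡ iter p l m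
  iter-∸ {k} {l} {m} {a} k≤l eq = begin
    iter p (l ∸ k) (just a)        ≡⟨ cong (iter p (l ∸ k)) eq ⟨
    iter p (l ∸ k) (iter p k m)    ≡⟨ iter-+ (l ∸ k) k m ⟨
    iter p (l ∸ k + k) m           ≡⟨ cong (λ i → iter p i m) (m∸n+n≡m k≤l) ⟩
    iter p l m                     ∎

  iter-defined-below : ∀ {k l m x} → k ≤ l → iter p l m ≡ just x → ∃[ w ] iter p k m ≡ just w
  iter-defined-below {k} {l} {m} {x} k≤l eq with iter p k m in eqₖ
  ... | just w  = w , refl
  ... | nothing = contradiction (begin
    just x                         ≡⟨ eq ⟨
    iter p l m                     ≡⟨ cong (λ i → iter p i m) (m∸n+n≡m k≤l) ⟨
    iter p (l ∸ k + k) m           ≡⟨ iter-+ (l ∸ k) k m ⟩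
    iter p (l ∸ k) (iter p k m)    ≡⟨ cong (iter p (l ∸ k)) eqₖ ⟩
    iter p (l ∸ k) nothing         ≡⟨ iter-nothing (l ∸ k) ⟩
    nothing                        ∎) λ ()

  Ancestor : Fin n → Fin n → Set
  Ancestor x v = ∃[ k ] iter p k (just v) ≡ just x

  ancestor-refl : ∀ {v} → Ancestor v v
  ancestor-refl = 0 , refl

  parent-ancestor : ∀ {v x} → p v ≡ just x → Ancestor x v
  parent-ancestor eq = 1 , eq

  ancestor-trans : ∀ {v y x} → Ancestor y v → Ancestor x y → Ancestor x v
  ancestor-trans {v} (k , eq) (l , eq') = l + k , trans (iter-+ l k (just v)) (trans (cong (iter p l) eq) eq')

  ancestors-comparable : ∀ {v a b} → Ancestor a v → Ancestor b v → Ancestor b a ⊎ Ancestor a b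
  ancestors-comparable (k , eqa) (l , eqb) with ≤-total k l
  ... | inj₁ k≤l = inj₁ (l ∸ k , trans (iter-∸ k≤l eqa) eqb)
  ... | inj₂ l≤k = inj₂ (k ∸ l , trans (iter-∸ l≤k eqb) eqa)

  ∈D⇒ancestor : ∀ {x v} → v ∈ D p x → Ancestor x v
  ∈D⇒ancestor {x} {v} v∈ with satisfied (any⁻ _ (upTo (suc n)) (∈-tabulate-if⁻ _ v v∈))
  ... | k , hit = k , toWitness hit

module Forest {n : ℕ} {p : Parent n} (reaches-root : ∀ v → ∃[ k ] iter p k (just v) ≡ nothing) where

  iter-periodic : ∀ {c a} → iter p c (just a) ≡ just a → ∀ m → iter p (m * c) (just a) ≡ just a
  iter-periodic eq zero          = refl
  iter-periodic {c} {a} eq (suc m) = begin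
    iter p (c + m * c) (just a)         ≡⟨ iter-+ p c (m * c) (just a) ⟩
    iter p c (iter p (m * c) (just a))  ≡⟨ cong (iter p c) (iter-periodic eq m) ⟩
    iter p c (just a)                   ≡⟨ eq ⟩
    just a                              ∎

  -- A cycle through a would be traversed r times, overshooting the r steps that lead from a to the root.
  no-cycle : ∀ {k a} → iter p k (just a) ≡ just a → k ≡ 0
  no-cycle {zero}  eq = refl
  no-cycle {suc k} {a} eq with reaches-root a
  ... | r , eqᵣ = contradiction (begin
    just a                               ≡⟨ iter-periodic eq r ⟨
    iter p (r * suc k) (just a)          ≡⟨ cong (λ i → iter p i (just a)) (trans (*-suc r k) (+-comm r (r * k))) ⟩
    iter p (r * k + r) (just a)          ≡⟨ iter-+ p (r * k) r (just a) ⟩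
    iter p (r * k) (iter p r (just a))   ≡⟨ cong (iter p (r * k)) eqᵣ ⟩
    iter p (r * k) nothing               ≡⟨ iter-nothing p (r * k) ⟩
    nothing                              ∎) λ ()

  no-revisit : ∀ {i j m w} → i < j → iter p i m ≡ just w → iter p j m ≢ just w
  no-revisit i<j eqᵢ eqⱼ =
    <⇒≢ (m<n⇒0<n∸m i<j) (sym (no-cycle (trans (iter-∸ p (<⇒≤ i<j) eqᵢ) eqⱼ)))

  ¬ancestor-of-parent : ∀ {z c} → p z ≡ just c → ¬ Ancestor p z c
  ¬ancestor-of-parent {z} {c} pz (k , eq) with m+n≡0⇒n≡0 k (no-cycle (begin
    iter p (k + 1) (just z)  ≡⟨ iter-+ p k 1 (just z) ⟩
    iter p k (p z)           ≡⟨ cong (iter p k) pz ⟩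
    iter p k (just c)        ≡⟨ eq ⟩
    just z                   ∎))
  ... | ()

  sibling-ancestor : ∀ {a b c} → p a ≡ just c → p b ≡ just c → Ancestor p b a → a ≡ b
  sibling-ancestor pa pb (zero  , eq) = just-injective eq
  sibling-ancestor {a} pa pb (suc k , eq) =
    contradiction (k , trans (cong (iter p k) (sym pa)) (trans (sym (iter-suc p k a)) eq)) (¬ancestor-of-parent pb)

  sibling-ancestors-equal : ∀ {a b c v} → p a ≡ just c → p b ≡ just c →
                            Ancestor p a v → Ancestor p b v → a ≡ b
  sibling-ancestors-equal pa pb anc-a anc-b with ancestors-comparable p anc-a anc-b
  ... | inj₁ b≼a = sibling-ancestor pa pb b≼a
  ... | inj₂ a≼b = sym (sibling-ancestor pb pa a≼b)

  -- The n + 1 vertices met in the first n steps cannot all be distinct.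
  ancestor-distance<n : ∀ {k v x} → iter p k (just v) ≡ just x → k < n
  ancestor-distance<n {k} {v} eq with k ℕ.<? n
  ... | yes k<n = k<n
  ... | no  k≮n = ⊥-elim (collision (pigeonhole (n<1+n n) vertexAt))
    where
    defined : ∀ (i : Fin (suc n)) → ∃[ w ] iter p (toℕ i) (just v) ≡ just w
    defined i = iter-defined-below p (≤-trans (toℕ≤pred[n] i) (≮⇒≥ k≮n)) eq
    vertexAt : Fin (suc n) → Fin n
    vertexAt i = proj₁ (defined i)
    collision : ¬ ∃₂ λ i j → i Fin.< j × vertexAt i ≡ vertexAt j
    collision (i , j , i<j , same) =
      no-revisit i<j (proj₂ (defined i)) (trans (proj₂ (defined j)) (cong just (sym same)))

  ancestor⇒∈D : ∀ {x v} → Ancestor p x v → v ∈ D p x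
  ancestor⇒∈D {x} {v} (k , eq) = ∈-tabulate-if⁺ _ v (any⁺ _ (lose k∈ (fromWitness eq)))
    where
    k∈ : k ∈ₗ upTo (suc n)
    k∈ = ∈-upTo⁺ (m<n⇒m<1+n (ancestor-distance<n eq))

  siblings-incomparable : ∀ {a b c} → p a ≡ just c → p b ≡ just c → a ≢ b → Incomparable p a b
  siblings-incomparable pa pb a≢b =
    (λ a∈ → a≢b (sibling-ancestor pa pb (∈D⇒ancestor p a∈))) ,
    (λ b∈ → a≢b (sym (sibling-ancestor pb pa (∈D⇒ancestor p b∈))))

module _ {n : ℕ} {s s' : Fin n} where

  mergeV-preimage : ∀ u {w} → mergeV s s' u ≡ w → u ≡ w ⊎ (u ≡ s' × w ≡ s)
  mergeV-preimage u eq with u ≟F s'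
  ... | yes u≡s' = inj₂ (u≡s' , sym eq)
  ... | no  _    = inj₁ eq

  mergeV-fixed : ∀ {w} → w ≢ s' → mergeV s s' w ≡ w
  mergeV-fixed {w} w≢s' with w ≟F s'
  ... | yes w≡s' = contradiction w≡s' w≢s'
  ... | no  _    = refl

  mergeM-just : ∀ {m w} → mergeM s s' m ≡ just w → ∃[ u ] m ≡ just u × mergeV s s' u ≡ w
  mergeM-just {just u} eq = u , refl , just-injective eq

  module _ {T T' : Parent n} (sc : SameContraction T T' s s') where

    parent-merges : ∀ {v w} → v ≢ s → v ≢ s' → T v ≡ just w → w ≢ s' →
                    ∃[ u ] T' v ≡ just u × mergeV s s' u ≡ w
    parent-merges {v} {w} v≢s v≢s' Tv w≢s' = mergeM-just (begin
      mergeM s s' (T' v)   ≡⟨ proj₁ sc v v≢s v≢s' ⟨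
      mergeM s s' (T v)    ≡⟨ cong (mergeM s s') Tv ⟩
      just (mergeV s s' w) ≡⟨ cong just (mergeV-fixed w≢s') ⟩
      just w               ∎)

    parent-agrees : ∀ {v w} → v ≢ s → v ≢ s' → T v ≡ just w → w ≢ s → w ≢ s' → T' v ≡ just w
    parent-agrees v≢s v≢s' Tv w≢s w≢s' with parent-merges v≢s v≢s' Tv w≢s'
    ... | u , T'v , merged with mergeV-preimage u merged
    ...   | inj₁ refl         = T'v
    ...   | inj₂ (_ , w≡s)    = contradiction w≡s w≢s

    parent-s-flips : ∀ {v} → s ≢ s' → v ≢ s → v ≢ s' → T v ≡ just s → T' v ≡ just s ⊎ T' v ≡ just s'
    parent-s-flips s≢s' v≢s v≢s' Tv with parent-merges v≢s v≢s' Tv s≢s'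
    ... | u , T'v , merged with mergeV-preimage u merged
    ...   | inj₁ refl         = inj₁ T'v
    ...   | inj₂ (refl , _)   = inj₂ T'v

module EdgeFlip {n : ℕ} {T T' : Parent n}
  (reaches-root  : ∀ v → ∃[ k ] iter T  k (just v) ≡ nothing)
  (reaches-root' : ∀ v → ∃[ k ] iter T' k (just v) ≡ nothing)
  {s s' : Fin n} (s≢s' : s ≢ s') (Ts : T s ≡ just s') (T's' : T' s' ≡ just s)
  (sc : SameContraction T T' s s') where

  module F  = Forest reaches-root
  module F' = Forest reaches-root'

  below-child-of-s : ∀ {z u} → T z ≡ just s → Ancestor T z u → u ≢ s × u ≢ s'
  below-child-of-s {z} {u} Tz z≼u = u≢s , u≢s'
    where
    u≢s : u ≢ s
    u≢s refl = F.¬ancestor-of-parent Tz z≼u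
    u≢s' : u ≢ s'
    u≢s' refl = F.¬ancestor-of-parent Tz (ancestor-trans T (parent-ancestor T Ts) z≼u)

  path-agrees : ∀ {z} → T z ≡ just s → ∀ k {v} → iter T k (just v) ≡ just z → iter T' k (just v) ≡ just z
  path-agrees Tz zero    eq = eq
  path-agrees {z} Tz (suc k) {v} eq with w , Tv ← iter-defined-below T {1} {suc k} (s≤s z≤n) eq = begin
    iter T' (suc k) (just v) ≡⟨ iter-suc T' k v ⟩
    iter T' k (T' v)         ≡⟨ cong (iter T' k) T'v ⟩
    iter T' k (just w)       ≡⟨ path-agrees Tz k eq' ⟩
    just z                   ∎
    where
    eq' : iter T k (just w) ≡ just z
    eq' = trans (cong (iter T k) (sym Tv)) (trans (sym (iter-suc T k v)) eq)
    T'v : T' v ≡ just w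
    T'v with v≢s , v≢s' ← below-child-of-s Tz (suc k , eq) | w≢s , w≢s' ← below-child-of-s Tz (k , eq') =
      parent-agrees sc v≢s v≢s' Tv w≢s w≢s'

  descendants-agree : ∀ {z v} → T z ≡ just s → Ancestor T z v → Ancestor T' z v
  descendants-agree Tz (k , eq) = k , path-agrees Tz k eq

  R : Fin n → Bool
  R = Rset T T' s s'

  ∈R⁻ : ∀ x → Bool.T (R x) → T x ≡ just s × T' x ≡ just s'
  ∈R⁻ x x∈R with Tx , T'x ← Equivalence.to (T-∧ {isChild T x s}) x∈R = toWitness Tx , toWitness T'x

  ∈R⁺ : ∀ {x} → T x ≡ just s → T' x ≡ just s' → Bool.T (R x)
  ∈R⁺ {x} Tx T'x = Equivalence.from (T-∧ {isChild T x s})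
    (fromWitness {a? = T x ≟M just s} Tx , fromWitness {a? = T' x ≟M just s'} T'x)

  descendant-of-R⇒∈∩ : ∀ x {v} → Bool.T (R x) → v ∈ D T x → v ∈ D T s ∩ D T' s'
  descendant-of-R⇒∈∩ x {v} x∈R v∈ with Tx , T'x ← ∈R⁻ x x∈R =
    x∈p∩q⁺ ( F.ancestor⇒∈D (ancestor-trans T x≼v (parent-ancestor T Tx))
           , F'.ancestor⇒∈D (ancestor-trans T' (descendants-agree Tx x≼v) (parent-ancestor T' T'x)))
    where
    x≼v : Ancestor T x v
    x≼v = ∈D⇒ancestor T v∈

  -- The child z of s in T on the path from v up to s is also a child of s or of s' in T';
  -- the former is impossible because v lies below the other child s' of s in T'.
  ∈∩⇒descendant-of-R : ∀ {v} → v ∈ D T s ∩ D T' s' → ∃[ x ] Bool.T (R x) × v ∈ D T x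
  ∈∩⇒descendant-of-R {v} v∈ with v∈Ds , v∈D's' ← x∈p∩q⁻ (D T s) (D T' s') v∈ | ∈D⇒ancestor T v∈Ds
  ... | zero  , refl = contradiction (∈D⇒ancestor T' v∈D's') (F'.¬ancestor-of-parent T's')
  ... | suc j , eq with iter T j (just v) in eqⱼ
  ...   | nothing = contradiction eq λ ()
  ...   | just z with z≢s , z≢s' ← below-child-of-s eq (ancestor-refl T) | parent-s-flips sc s≢s' z≢s z≢s' eq
  ...     | inj₂ T'z = z , ∈R⁺ eq T'z , F.ancestor⇒∈D (j , eqⱼ)
  ...     | inj₁ T'z = contradiction
    (F'.sibling-ancestors-equal T'z T's' (descendants-agree eq (j , eqⱼ)) (∈D⇒ancestor T' v∈D's')) z≢s'

  Rs : List (Fin n)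
  Rs = filterᵇ R (allFin n)

  ∈Rs : ∀ {x} → Bool.T (R x) → x ∈ₗ Rs
  ∈Rs {x} x∈R = ∈-filter⁺ (T? ∘ R) (∈-allFin x) x∈R

  ∩≡⋃R : D T s ∩ D T' s' ≡ ⋃ (map (D T) Rs)
  ∩≡⋃R = ⊆-antisym ⊆⋃ ⋃⊆
    where
    ⊆⋃ : ∀ {v} → v ∈ D T s ∩ D T' s' → v ∈ ⋃ (map (D T) Rs)
    ⊆⋃ v∈ with x , x∈R , v∈Dx ← ∈∩⇒descendant-of-R v∈ =
      ∈-⋃⁺ (∈-map⁺ (D T) (∈Rs x∈R)) v∈Dx
    ⋃⊆ : ∀ {v} → v ∈ ⋃ (map (D T) Rs) → v ∈ D T s ∩ D T' s'
    ⋃⊆ v∈ with X , X∈ , v∈X ← ∈-⋃⁻ (map (D T) Rs) v∈ | ∈-map⁻ (D T) X∈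
    ... | x , x∈Rs , refl = descendant-of-R⇒∈∩ x (proj₂ (∈-filter⁻ (T? ∘ R) {xs = allFin n} x∈Rs)) v∈X

  R-subsingleton : ∀ {B} → IsMaximalBTree B T → B (D T s ∩ D T' s') ⊎ (D T s ∩ D T' s' ≡ ⊥) →
                   ∀ x y → Bool.T (R x) → Bool.T (R y) → x ≡ y
  R-subsingleton _ (inj₂ ∩≡⊥) x _ x∈R _ =
    contradiction (subst (x ∈_) ∩≡⊥ (descendant-of-R⇒∈∩ x x∈R (F.ancestor⇒∈D (ancestor-refl T)))) ∉⊥
  R-subsingleton {B} maximal (inj₁ ∩∈B) x y x∈R y∈R with x ≟F y
  ... | yes x≡y = x≡y
  ... | no  x≢y = contradiction (subst B ∩≡⋃R ∩∈B) (IsMaximalBTree.antichain maximal Rs two-members antichain)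
    where
    two-members : 2 ≤ length Rs
    two-members = distinct-members⇒2≤length (∈Rs x∈R) (∈Rs y∈R) x≢y
    antichain : AllPairs (Incomparable T) Rs
    antichain = allPairs-within
      (λ {a} {b} a∈R b∈R → F.siblings-incomparable (proj₁ (∈R⁻ a a∈R)) (proj₁ (∈R⁻ b b∈R)))
      (all-filter (T? ∘ R) (allFin n)) (AllPairs.filter⁺ (T? ∘ R) (allFin⁺ n))

sumOver-zero : ∀ {n} (P : Fin n → Bool) (f : Fin n → ℕ) → (∀ x → Bool.T (P x) → f x ≡ 0) → sumOver P f ≡ 0
sumOver-zero {n} P f f≡0 = sum-zero (allFin n)
  where
  sum-zero : ∀ xs → sum (map (λ x → if P x then f x else 0) xs) ≡ 0
  sum-zero []       = refl
  sum-zero (x ∷ xs) with P x in Px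
  ... | true  = cong₂ _+_ (f≡0 x (subst Bool.T (sym Px) tt)) (sum-zero xs)
  ... | false = sum-zero xs

π-subsingleton : ∀ {n} (p : Parent n) (X : Fin n → Bool) →
                 (∀ x y → Bool.T (X x) → Bool.T (X y) → x ≡ y) → π p X ≡ 0
π-subsingleton p X unique = sumOver-zero X _ λ x x∈X → sumOver-zero _ _ λ y y∈X∧x<y →
  let y∈X , x<y = Equivalence.to (T-∧ {X y}) y∈X∧x<y in
  contradiction (<ᵇ⇒< (toℕ x) (toℕ y) x<y) (<-irrefl (cong toℕ (unique x y x∈X y∈X)))

-- (δ_S+1)(δ_{S'}+1) makes the natural-number part of Δ a successor by computation.
Δ-positive : ∀ {n} (T T' : Parent n) s s' → π T (Rset T T' s s') ≡ 0 → + 0 ℤ.< Δ T T' s s'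
Δ-positive T T' s s' π≡0 rewrite π≡0 = +<+ z<s

lemma3p5 : {n : ℕ} (B : Subset n → Set) → IsBuildingSet B → IsConnected B →
    (T T' : Parent n) → IsMaximalBTree B T → IsMaximalBTree B T' →
    (s s' : Fin n) → s ≢ s' → T s ≡ just s' → T' s' ≡ just s →
    SameContraction T T' s s' →
    (B (D T s ∩ D T' s') ⊎ (D T s ∩ D T' s' ≡ ⊥)) →
    + 0 ℤ.< Δ T T' s s'
lemma3p5 B _ _ T T' maximal maximal' s s' s≢s' Ts T's' sc hyp =
  Δ-positive T T' s s' (π-subsingleton T (Rset T T' s s') (R-subsingleton maximal hyp))
  where
  open EdgeFlip (IsRootedTree.reaches (IsMaximalBTree.tree maximal))
                (IsRootedTree.reaches (IsMaximalBTree.tree maximal')) s≢s' Ts T's' sc
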